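{- Let $K$ be a number field with ring of integers $\mathscr O$ and let $m$ be the positive integer with $\mathrm{Trace}_{K/\mathbb Q}(\mathscr O)=m\mathbb Z$. Then the lattice $(\mathscr O,\mathrm{tr}_{K,\mathrm{id}})$, where $\mathrm{tr}_{K,\mathrm{id}}(x,y)=\mathrm{Trace}_{K/\mathbb Q}(xy)$, is even if and only if $m$ is even.
   Context: A lattice $(L,b)$ is even if $b(x,x)\in2\mathbb Z$ for all $x\in L$. -}

module Defs where

open import Data.Nat as ℕ using (ℕ; zero; suc)
open import Data.Integer as ℤ using (ℤ)
open import Data.Rational using (ℚ; 0ℚ; 1ℚ; _+_; _*_; _/_)
open import Data.Fin using (Fin; zero; suc)
open import Data.List using (List; []; _∷_; length)
open import Data.Product using (Σ; ∃; _×_)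
open import Relation.Binary.PropositionalEquality using (_≡_)
open import Relation.Nullary using (¬_)
import Data.Fin
import Relation.Nullary
import Data.Integer.Divisibility

toℚ : ℤ → ℚ
toℚ z = z / 1

∑ : (n : ℕ) → (Fin n → ℚ) → ℚ
∑ zero    f = 0ℚ
∑ (suc n) f = f zero + ∑ n (λ i → f (suc i))

-- vectors in ℚ^n (coordinates w.r.t. a fixed ℚ-basis e_0 … e_{n-1})
Vecℚ : ℕ → Set
Vecℚ n = Fin n → ℚ

_≈_ : ∀ {n} → Vecℚ n → Vecℚ n → Set
x ≈ y = ∀ i → x i ≡ y i

zeroV : ∀ {n} → Vecℚ n
zeroV _ = 0ℚ

_⊕_ : ∀ {n} → Vecℚ n → Vecℚ n → Vecℚ n
(x ⊕ y) i = x i + y i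

scale : ∀ {n} → ℚ → Vecℚ n → Vecℚ n
scale a x i = a * x i

-- bilinear multiplication given by structure constants c i j k :
-- e_i · e_j = Σ_k c i j k e_k
mulSC : ∀ {n} → (Fin n → Fin n → Fin n → ℚ) → Vecℚ n → Vecℚ n → Vecℚ n
mulSC {n} c x y k = ∑ n (λ i → ∑ n (λ j → x i * y j * c i j k))

-- A number field K: a finite-dimensional ℚ-algebra ℚ^n (with basis),
-- commutative, associative, unital, in which 1 ≠ 0 and every nonzero
-- element is invertible.
record NumberField : Set where
  field
    deg   : ℕ
    c     : Fin deg → Fin deg → Fin deg → ℚ
    one   : Vecℚ deg
  _·_ : Vecℚ deg → Vecℚ deg → Vecℚ deg
  _·_ = mulSC c
  field
    ·-comm  : ∀ x y → (x · y) ≈ (y · x)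
    ·-assoc : ∀ x y z → ((x · y) · z) ≈ (x · (y · z))
    ·-unit  : ∀ x → (one · x) ≈ x
    one≢0   : ¬ (one ≈ zeroV)
    inverse : ∀ x → ¬ (x ≈ zeroV) → Σ (Vecℚ deg) (λ y → (x · y) ≈ one)

module _ (K : NumberField) where
  open NumberField K

  Elt : Set
  Elt = Vecℚ deg

  basis : Fin deg → Elt
  basis i j with Data.Fin._≟_ i j
  ... | Relation.Nullary.yes _ = 1ℚ
  ... | Relation.Nullary.no  _ = 0ℚ

  pow : Elt → ℕ → Elt
  pow x zero    = one
  pow x (suc k) = x · pow x k

  evalFrom : List ℤ → Elt → ℕ → Elt
  evalFrom []       x k = zeroV
  evalFrom (a ∷ as) x k = scale (toℚ a) (pow x k) ⊕ evalFrom as x (suc k)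

  -- x is an algebraic integer: root of a monic integer polynomial
  -- X^d + a_{d-1} X^{d-1} + … + a_0, where d = length as
  IsIntegral : Elt → Set
  IsIntegral x = ∃ λ (as : List ℤ) → (pow x (length as) ⊕ evalFrom as x 0) ≈ zeroV

  -- Trace_{K/ℚ}(x) = trace of the ℚ-linear map y ↦ x·y
  Trace : Elt → ℚ
  Trace x = ∑ deg (λ i → (x · basis i) i)

  trId : Elt → Elt → ℚ
  trId x y = Trace (x · y)

  IsEvenLattice : Set
  IsEvenLattice = ∀ x → IsIntegral x → ∃ λ (k : ℤ) → trId x x ≡ toℚ (ℤ.+ 2 ℤ.* k)

  TraceImage≡ : ℕ → Set
  TraceImage≡ m = ∀ (z : ℤ) →
    ((∃ λ x → IsIntegral x × (Trace x ≡ toℚ z)) → ℤ.+ m Data.Integer.Divisibility.∣ z)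
    × (ℤ.+ m Data.Integer.Divisibility.∣ z → ∃ λ x → IsIntegral x × (Trace x ≡ toℚ z))

-- For an algebraic integer x with a monic relation of degree d, the ℤ-module spanned by the vectors
-- x^i e_j (i < d) contains every e_j and is stable under multiplication by x. Clearing denominators
-- makes it a full-rank sublattice of ℤⁿ, which has a triangular ℤ-basis (Hermite reduction, using
-- Bézout). In that basis multiplication by x is an integer matrix A, so Trace x = tr A and
-- Trace x² = tr A² = Σ_k A_kk² + 2 Σ_{k<l} A_kl A_lk ≡ tr A (mod 2). Hence tr(x, x) is even exactly
-- when Trace x is, and the lattice is even iff every element of Trace(𝒪) = mℤ is even, i.e. iff 2 ∣ m.

module Submission where

open import Defs
open import Data.Nat using (ℕ; _<_)
open import Data.Nat.Divisibility using (_∣_)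
open import Function.Bundles using (_⇔_)

open import Level using (0ℓ)
open import Algebra.Bundles using (CommutativeRing)
open import Data.Nat as ℕ using (zero; suc)
import Data.Nat.Properties as ℕP
import Data.Integer.Properties as ℤP
import Data.Rational.Properties as ℚP
open import Data.Fin using (Fin; zero; suc)
open import Data.Product using (∃; ∃₂; _,_; proj₁; proj₂; _×_)
open import Function using (_∘_)

module LinearCombinations (R : CommutativeRing 0ℓ 0ℓ) where

  open import Data.Bool using (if_then_else_)
  open import Data.Fin.Properties using (_≟_)
  open import Data.Unit using (⊤)
  open import Relation.Nullary using (does; ¬_)

  open CommutativeRing R hiding (zero) renaming (_≈_ to _≃_)
  open import Algebra.Properties.Ring ring using (-‿+-comm; -0#≈0#; -‿distribˡ-*)
  open import Algebra.Properties.Semiring.Sum semiring public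
    using (sum; sum-syntax; sum-cong-≋; sum-replicate-zero; ∑-distrib-+; ∑-comm; *-distribˡ-sum; *-distribʳ-sum)
  open import Relation.Binary.Reasoning.Setoid setoid

  ∑-neg : ∀ n (f : Fin n → Carrier) → ∑[ i < n ] (- f i) ≃ - (∑[ i < n ] f i)
  ∑-neg zero    f = sym -0#≈0#
  ∑-neg (suc n) f = trans (+-congˡ (∑-neg n (f ∘ suc))) (-‿+-comm _ _)

  δ : ∀ {n} → Fin n → Fin n → Carrier
  δ i j = if does (i ≟ j) then 1# else 0#

  δ-sym : ∀ {n} (i j : Fin n) → δ i j ≃ δ j i
  δ-sym zero    zero    = refl
  δ-sym zero    (suc j) = refl
  δ-sym (suc i) zero    = refl
  δ-sym (suc i) (suc j) = δ-sym i j

  ∑-δˡ : ∀ n (i : Fin n) (f : Fin n → Carrier) → ∑[ j < n ] (δ i j * f j) ≃ f i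
  ∑-δˡ (suc n) zero f = begin
    1# * f zero + ∑[ j < n ] (0# * f (suc j)) ≈⟨ +-cong (*-identityˡ _) (sum-cong-≋ {n} (λ j → zeroˡ (f (suc j)))) ⟩
    f zero + ∑[ j < n ] 0#                    ≈⟨ +-congˡ (sum-replicate-zero n) ⟩
    f zero + 0#                               ≈⟨ +-identityʳ _ ⟩
    f zero                                    ∎
  ∑-δˡ (suc n) (suc i) f = begin
    0# * f zero + ∑[ j < n ] (δ i j * f (suc j)) ≈⟨ +-cong (zeroˡ _) (∑-δˡ n i _) ⟩
    0# + f (suc i)                               ≈⟨ +-identityˡ _ ⟩
    f (suc i)                                    ∎

  ∑-δʳ : ∀ n (i : Fin n) (f : Fin n → Carrier) → ∑[ j < n ] (f j * δ j i) ≃ f i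
  ∑-δʳ n i f = trans (sum-cong-≋ {n} (λ j → trans (*-comm (f j) _) (*-congʳ (δ-sym j i)))) (∑-δˡ n i f)

  linComb : ∀ {N n} → (Fin N → Carrier) → (Fin N → Fin n → Carrier) → Fin n → Carrier
  linComb {N} c G i = ∑[ r < N ] (c r * G r i)

  infixl 7 _⊛_
  _⊛_ : ∀ {m N n} → (Fin m → Fin N → Carrier) → (Fin N → Fin n → Carrier) → Fin m → Fin n → Carrier
  (X ⊛ Y) i = linComb (X i) Y

  linComb-congʳ : ∀ {N n} (c : Fin N → Carrier) {G H : Fin N → Fin n → Carrier} →
    (∀ r i → G r i ≃ H r i) → ∀ i → linComb c G i ≃ linComb c H i
  linComb-congʳ {N} c G≃H i = sum-cong-≋ {N} (λ r → *-congˡ (G≃H r i))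

  linComb-⊛ : ∀ {M N n} (c : Fin M → Carrier) (E : Fin M → Fin N → Carrier) (G : Fin N → Fin n → Carrier) i →
    linComb c (E ⊛ G) i ≃ linComb (linComb c E) G i
  linComb-⊛ {M} {N} c E G i = begin
    ∑[ r < M ] (c r * (∑[ s < N ] (E r s * G s i)))  ≈⟨ sum-cong-≋ {M} (λ r → *-distribˡ-sum {N} (c r) (λ s → E r s * G s i)) ⟩
    ∑[ r < M ] ∑[ s < N ] (c r * (E r s * G s i))    ≈⟨ ∑-comm {M} {N} (λ r s → c r * (E r s * G s i)) ⟩
    ∑[ s < N ] ∑[ r < M ] (c r * (E r s * G s i))
      ≈⟨ sum-cong-≋ {N} (λ s → trans (sum-cong-≋ {M} (λ r → sym (*-assoc _ _ _))) (sym (*-distribʳ-sum {M} (G s i) (λ r → c r * E r s)))) ⟩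
    ∑[ s < N ] ((∑[ r < M ] (c r * E r s)) * G s i)  ∎

  linComb-sub : ∀ {N n} (c d : Fin N → Carrier) (G : Fin N → Fin n → Carrier) i →
    linComb (λ r → c r - d r) G i ≃ linComb c G i - linComb d G i
  linComb-sub {N} c d G i = begin
    ∑[ r < N ] ((c r - d r) * G r i)
      ≈⟨ sum-cong-≋ {N} (λ r → trans (distribʳ (G r i) (c r) (- d r)) (+-congˡ (sym (-‿distribˡ-* (d r) (G r i))))) ⟩
    ∑[ r < N ] (c r * G r i - d r * G r i)       ≈⟨ ∑-distrib-+ {N} (λ r → c r * G r i) (λ r → - (d r * G r i)) ⟩
    linComb c G i + ∑[ r < N ] (- (d r * G r i)) ≈⟨ +-congˡ (∑-neg N _) ⟩
    linComb c G i - linComb d G i                ∎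

  linComb-scaleˡ : ∀ {N n} a (c : Fin N → Carrier) (G : Fin N → Fin n → Carrier) i →
    linComb (λ r → a * c r) G i ≃ a * linComb c G i
  linComb-scaleˡ {N} a c G i = trans (sum-cong-≋ {N} (λ r → *-assoc a (c r) (G r i))) (sym (*-distribˡ-sum {N} a (λ r → c r * G r i)))

  linComb-scaleʳ : ∀ {N n} a (c : Fin N → Carrier) (G : Fin N → Fin n → Carrier) i →
    linComb c (λ r j → a * G r j) i ≃ a * linComb c G i
  linComb-scaleʳ {N} a c G i = trans (sum-cong-≋ {N} (λ r → trans (sym (*-assoc _ _ _)) (trans (*-congʳ (*-comm (c r) a)) (*-assoc _ _ _))))
                                     (sym (*-distribˡ-sum {N} a (λ r → c r * G r i)))

  linComb-δ : ∀ {n m} (a : Carrier) (l : Fin n) (G : Fin n → Fin m → Carrier) i →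
    linComb (λ k → a * δ l k) G i ≃ a * G l i
  linComb-δ {n} a l G i = trans (linComb-scaleˡ a (δ l) G i) (*-congˡ (∑-δˡ n l _))

  Triangular : ∀ n → (Fin n → Fin n → Carrier) → Set
  Triangular zero    b = ⊤
  Triangular (suc n) b = ¬ (b zero zero ≃ 0#) × (∀ k → b (suc k) zero ≃ 0#) × Triangular n (λ k i → b (suc k) (suc i))

  InSpan : ∀ {N n} → (Fin N → Fin n → Carrier) → (Fin n → Carrier) → Set
  InSpan G v = ∃ λ c → ∀ i → v i ≃ linComb c G i

  ScaledUnitsInSpan : ∀ {N n} → Carrier → (Fin N → Fin n → Carrier) → Set
  ScaledUnitsInSpan D G = ∀ j → InSpan G (λ i → D * δ j i)

  trace : ∀ {n} → (Fin n → Fin n → Carrier) → Carrier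
  trace {n} A = ∑[ k < n ] A k k

  linComb-scaledUnits : ∀ {n} (c : Fin n → Carrier) a j → linComb c (λ l k → a * δ l k) j ≃ a * c j
  linComb-scaledUnits {n} c a j = trans (linComb-scaleʳ a c δ j) (*-congˡ (∑-δʳ n j c))

  trace-⊛-comm : ∀ {m n} (X : Fin m → Fin n → Carrier) (Y : Fin n → Fin m → Carrier) → trace (X ⊛ Y) ≃ trace (Y ⊛ X)
  trace-⊛-comm {m} {n} X Y = trans (∑-comm {m} {n} (λ i k → X i k * Y k i)) (sum-cong-≋ {n} (λ k → sum-cong-≋ {m} (λ i → *-comm (X i k) (Y k i))))

module ℤL = LinearCombinations ℤP.+-*-commutativeRing
module ℚL = LinearCombinations ℚP.+-*-commutativeRing

module IntegerLattices where

  open import Data.Integer as ℤ using (ℤ; +_; -[1+_]; ∣_∣; _+_; _*_; -_; _-_)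
  open import Data.Integer.Divisibility.Signed as ℤ using (divides; ∣ᵤ⇒∣; ∣-trans; quotient)
  open import Data.Integer.Tactic.RingSolver using (solve-∀)
  import Data.Nat.GCD as ℕGCD
  open ℕGCD.Bézout using (result; +-; -+)
  open import Data.Vec.Functional using (_∷_)
  open import Data.Unit using (tt)
  open import Function.Bundles using (mk⇔)
  open import Relation.Binary.PropositionalEquality
  open ≡-Reasoning
  open ℤL using (sum-syntax; linComb; δ; Triangular; InSpan; ScaledUnitsInSpan)

  private
    sgn : ℤ → ℤ
    sgn (+ n)    = + 1
    sgn -[1+ n ] = - + 1

    sgn*i≡∣i∣ : ∀ i → sgn i * i ≡ + ∣ i ∣
    sgn*i≡∣i∣ (+ n)    = ℤP.*-identityˡ (+ n)
    sgn*i≡∣i∣ -[1+ n ] = ℤP.-1*i≡-i -[1+ n ]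

    bezout-signs : ∀ a b d x y → d ℕ.+ y ℕ.* ∣ b ∣ ≡ x ℕ.* ∣ a ∣ → (+ x * sgn a) * a + (- + y * sgn b) * b ≡ + d
    bezout-signs a b d x y eq = begin
      (+ x * sgn a) * a + (- + y * sgn b) * b    ≡⟨ regroup (+ x) (sgn a) a (+ y) (sgn b) b ⟩
      + x * (sgn a * a) - + y * (sgn b * b)      ≡⟨ cong₂ (λ p q → + x * p - + y * q) (sgn*i≡∣i∣ a) (sgn*i≡∣i∣ b) ⟩
      + x * + ∣ a ∣ - + y * + ∣ b ∣              ≡⟨ cong (_- + y * + ∣ b ∣) (sym eqℤ) ⟩
      + d + + y * + ∣ b ∣ - + y * + ∣ b ∣        ≡⟨ cancel (+ d) (+ y * + ∣ b ∣) ⟩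
      + d                                        ∎
      where
      regroup : ∀ x s a y t b → (x * s) * a + (- y * t) * b ≡ x * (s * a) - y * (t * b)
      regroup = solve-∀
      cancel : ∀ d z → d + z - z ≡ d
      cancel = solve-∀
      eqℤ : + d + + y * + ∣ b ∣ ≡ + x * + ∣ a ∣
      eqℤ = trans (cong (λ z → + d + z) (sym (ℤP.pos-* y ∣ b ∣)))
              (trans (sym (ℤP.pos-+ d (y ℕ.* ∣ b ∣))) (trans (cong +_ eq) (ℤP.pos-* x ∣ a ∣)))

  bezout : ∀ a b → ∃ λ g → (g ℤ.∣ a) × (g ℤ.∣ b) × ∃₂ λ u v → u * a + v * b ≡ g
  bezout a b with ℕGCD.Bézout.lemma ∣ a ∣ ∣ b ∣
  ... | result d gcd identity = + d , ∣ᵤ⇒∣ d∣a , ∣ᵤ⇒∣ d∣b , coefficients identity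
    where
    open ℕGCD.GCD.GCD gcd using () renaming (gcd∣m to d∣a; gcd∣n to d∣b)
    coefficients : ℕGCD.Bézout.Identity d ∣ a ∣ ∣ b ∣ → ∃₂ λ u v → u * a + v * b ≡ + d
    coefficients (+- x y eq) = + x * sgn a , - + y * sgn b , bezout-signs a b d x y eq
    coefficients (-+ x y eq) = - + x * sgn a , + y * sgn b ,
      trans (ℤP.+-comm ((- + x * sgn a) * a) _) (bezout-signs b a d y x eq)

  gcd-combination : ∀ N (f : Fin N → ℤ) → ∃ λ g → (∀ r → g ℤ.∣ f r) × ∃ λ (u : Fin N → ℤ) → ∑[ r < N ] (u r * f r) ≡ g
  gcd-combination zero    f = + 0 , (λ ()) , (λ ()) , refl
  gcd-combination (suc N) f with gcd-combination N (f ∘ suc)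
  ... | g′ , g′∣f , u′ , eq′ with bezout (f zero) g′
  ... | g , g∣f₀ , g∣g′ , a , b , eq = g , g∣f , u , combination
    where
    g∣f : ∀ r → g ℤ.∣ f r
    g∣f zero    = g∣f₀
    g∣f (suc r) = ∣-trans g∣g′ (g′∣f r)
    u : Fin (suc N) → ℤ
    u zero    = a
    u (suc r) = b * u′ r
    combination : a * f zero + ∑[ r < N ] (b * u′ r * f (suc r)) ≡ g
    combination = begin
      a * f zero + ∑[ r < N ] (b * u′ r * f (suc r))   ≡⟨ cong (_+_ (a * f zero)) (ℤL.linComb-scaleˡ {N} {1} b u′ (λ r _ → f (suc r)) zero) ⟩
      a * f zero + b * ∑[ r < N ] (u′ r * f (suc r))   ≡⟨ cong (λ z → a * f zero + b * z) eq′ ⟩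
      a * f zero + b * g′                              ≡⟨ eq ⟩
      g                                                ∎

  record TriangularBasis {N n} (G : Fin N → Fin n → ℤ) : Set where
    field
      vectors      : Fin n → Fin n → ℤ
      triangular   : Triangular n vectors
      vectors∈span : ∀ k → InSpan G (vectors k)
      span⊆span    : ∀ v → InSpan G v → InSpan vectors v

  -- One step of Hermite reduction: a ℤ-combination of the rows realises the gcd g of the first
  -- column (the pivot), and subtracting multiples of the pivot clears the first column.
  module HermiteStep {N n} (G : Fin N → Fin (suc n) → ℤ) {D : ℤ} (D≢0 : D ≢ + 0) (units : ScaledUnitsInSpan D G) where

    private
      column-gcd = gcd-combination N (λ r → G r zero)

    g : ℤ
    g = proj₁ column-gcd

    h : Fin N → ℤ
    h r = quotient (proj₁ (proj₂ column-gcd) r)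

    u : Fin N → ℤ
    u = proj₁ (proj₂ (proj₂ column-gcd))

    pivot : Fin (suc n) → ℤ
    pivot = linComb u G

    pivot-zero : pivot zero ≡ g
    pivot-zero = proj₂ (proj₂ (proj₂ column-gcd))

    weight : (Fin N → ℤ) → ℤ
    weight c = ∑[ r < N ] (c r * h r)

    reduced : Fin N → Fin n → ℤ
    reduced r i = G r (suc i) - h r * pivot (suc i)

    linComb-zero : ∀ c → linComb c G zero ≡ weight c * g
    linComb-zero c = begin
      ∑[ r < N ] (c r * G r zero)      ≡⟨ ℤL.sum-cong-≋ {N} (λ r → trans (cong (c r *_) (G≡h*g r)) (sym (ℤP.*-assoc (c r) (h r) g))) ⟩
      ∑[ r < N ] (c r * h r * g)       ≡⟨ ℤL.*-distribʳ-sum {N} g (λ r → c r * h r) ⟨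
      weight c * g                     ∎
      where
      G≡h*g : ∀ r → G r zero ≡ h r * g
      G≡h*g r = ℤ._∣_.equality (proj₁ (proj₂ column-gcd) r)

    linComb-reduced : ∀ c i → linComb c reduced i ≡ linComb c G (suc i) - weight c * pivot (suc i)
    linComb-reduced c i = begin
      ∑[ r < N ] (c r * (G r (suc i) - h r * p))           ≡⟨ ℤL.sum-cong-≋ {N} (λ r → expand (c r) (G r (suc i)) (h r) p) ⟩
      ∑[ r < N ] (c r * G r (suc i) + - (c r * h r * p))   ≡⟨ ℤL.∑-distrib-+ {N} (λ r → c r * G r (suc i)) (λ r → - (c r * h r * p)) ⟩
      linComb c G (suc i) + ∑[ r < N ] (- (c r * h r * p)) ≡⟨ cong (_+_ (linComb c G (suc i))) (ℤL.∑-neg N (λ r → c r * h r * p)) ⟩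
      linComb c G (suc i) - ∑[ r < N ] (c r * h r * p)     ≡⟨ cong (λ z → linComb c G (suc i) - z) (ℤL.*-distribʳ-sum {N} p (λ r → c r * h r)) ⟨
      linComb c G (suc i) - weight c * p                   ∎
      where
      p = pivot (suc i)
      expand : ∀ c a h p → c * (a - h * p) ≡ c * a + - (c * h * p)
      expand = solve-∀

    linComb-suc : ∀ c i → linComb c G (suc i) ≡ weight c * pivot (suc i) + linComb c reduced i
    linComb-suc c i = trans (sym (split (linComb c G (suc i)) (weight c * pivot (suc i))))
                            (cong (_+_ (weight c * pivot (suc i))) (sym (linComb-reduced c i)))
      where
      split : ∀ a b → b + (a - b) ≡ a
      split = solve-∀

    g≢0 : g ≢ + 0
    g≢0 g≡0 with units zero
    ... | c , eq = D≢0 (begin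
      D                     ≡⟨ ℤP.*-identityʳ D ⟨
      D * + 1               ≡⟨ eq zero ⟩
      linComb c G zero      ≡⟨ linComb-zero c ⟩
      weight c * g          ≡⟨ cong (weight c *_) g≡0 ⟩
      weight c * + 0        ≡⟨ ℤP.*-zeroʳ (weight c) ⟩
      + 0                   ∎)

    weight≡0 : ∀ c → linComb c G zero ≡ + 0 → weight c ≡ + 0
    weight≡0 c eq = ℤP.*-cancelʳ-≡ (weight c) (+ 0) g {{ℤ.≢-nonZero g≢0}} (trans (sym (linComb-zero c)) eq)

    reduced-units : ScaledUnitsInSpan D reduced
    reduced-units j with units (suc j)
    ... | c , eq = c , λ i → begin
      D * δ j i                                         ≡⟨ eq (suc i) ⟩
      linComb c G (suc i)                               ≡⟨ linComb-suc c i ⟩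
      weight c * pivot (suc i) + linComb c reduced i    ≡⟨ cong (λ w → w * pivot (suc i) + linComb c reduced i) w≡0 ⟩
      + 0 * pivot (suc i) + linComb c reduced i         ≡⟨ ℤP.+-identityˡ _ ⟩
      linComb c reduced i                               ∎
      where
      w≡0 : weight c ≡ + 0
      w≡0 = weight≡0 c (trans (sym (eq zero)) (ℤP.*-zeroʳ D))

    module Extend (B′ : TriangularBasis reduced) where

      module B′ = TriangularBasis B′

      vectors : Fin (suc n) → Fin (suc n) → ℤ
      vectors zero            = pivot
      vectors (suc k) zero    = + 0
      vectors (suc k) (suc i) = B′.vectors k i

      linComb-shift : ∀ c t i → linComb (λ r → c r - t * u r) G i ≡ linComb c G i - t * pivot i
      linComb-shift c t i = trans (ℤL.linComb-sub c (λ r → t * u r) G i) (cong (λ z → linComb c G i - z) (ℤL.linComb-scaleˡ t u G i))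

      lift∈span : ∀ k c′ → (∀ i → B′.vectors k i ≡ linComb c′ reduced i) →
        ∀ i → vectors (suc k) i ≡ linComb (λ r → c′ r - weight c′ * u r) G i
      lift∈span k c′ eq′ zero = sym (begin
        linComb (λ r → c′ r - w * u r) G zero   ≡⟨ linComb-shift c′ w zero ⟩
        linComb c′ G zero - w * pivot zero      ≡⟨ cong₂ (λ a b → a - w * b) (linComb-zero c′) pivot-zero ⟩
        w * g - w * g                           ≡⟨ ℤP.+-inverseʳ (w * g) ⟩
        + 0                                     ∎)
        where w = weight c′
      lift∈span k c′ eq′ (suc i) = trans (eq′ i) (trans (linComb-reduced c′ i) (sym (linComb-shift c′ (weight c′) (suc i))))

      vectors∈span : ∀ k → InSpan G (vectors k)
      vectors∈span zero    = u , λ _ → refl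
      vectors∈span (suc k) = (λ r → c′ r - weight c′ * u r) , lift∈span k c′ (proj₂ (B′.vectors∈span k))
        where c′ = proj₁ (B′.vectors∈span k)

      expand-in-vectors : ∀ (v : Fin (suc n) → ℤ) c → (∀ i → v i ≡ linComb c G i) → ∀ c₃ →
        (∀ i → v (suc i) - weight c * pivot (suc i) ≡ linComb c₃ B′.vectors i) → ∀ i → v i ≡ linComb (weight c ∷ c₃) vectors i
      expand-in-vectors v c eq c₃ eq₃ zero = begin
        v zero                                   ≡⟨ eq zero ⟩
        linComb c G zero                         ≡⟨ linComb-zero c ⟩
        t * g                                    ≡⟨ cong (t *_) pivot-zero ⟨
        t * pivot zero                           ≡⟨ ℤP.+-identityʳ _ ⟨
        t * pivot zero + + 0                     ≡⟨ cong (_+_ (t * pivot zero)) zeros ⟨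
        t * pivot zero + ∑[ k < n ] (c₃ k * + 0) ∎
        where
        t = weight c
        zeros : ∑[ k < n ] (c₃ k * + 0) ≡ + 0
        zeros = trans (ℤL.sum-cong-≋ {n} (λ k → ℤP.*-zeroʳ (c₃ k))) (ℤL.sum-replicate-zero n)
      expand-in-vectors v c eq c₃ eq₃ (suc i) = begin
        v (suc i)                                             ≡⟨ split (v (suc i)) (t * pivot (suc i)) ⟨
        t * pivot (suc i) + (v (suc i) - t * pivot (suc i))   ≡⟨ cong (_+_ (t * pivot (suc i))) (eq₃ i) ⟩
        t * pivot (suc i) + linComb c₃ B′.vectors i           ∎
        where
        t = weight c
        split : ∀ a b → b + (a - b) ≡ a
        split = solve-∀

      span⊆span : ∀ v → InSpan G v → InSpan vectors v
      span⊆span v (c , eq) = weight c ∷ proj₁ tail , expand-in-vectors v c eq (proj₁ tail) (proj₂ tail)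
        where
        tail∈span : ∀ i → v (suc i) - weight c * pivot (suc i) ≡ linComb c reduced i
        tail∈span i = trans (cong (λ z → z - weight c * pivot (suc i)) (eq (suc i))) (sym (linComb-reduced c i))
        tail : InSpan B′.vectors (λ i → v (suc i) - weight c * pivot (suc i))
        tail = B′.span⊆span (λ i → v (suc i) - weight c * pivot (suc i)) (c , tail∈span)

      extended : TriangularBasis G
      extended = record
        { vectors      = vectors
        ; triangular   = (λ e → g≢0 (trans (sym pivot-zero) e)) , (λ _ → refl) , B′.triangular
        ; vectors∈span = vectors∈span
        ; span⊆span    = span⊆span
        }

  triangularBasis : ∀ {N} n (G : Fin N → Fin n → ℤ) {D} → D ≢ + 0 → ScaledUnitsInSpan D G → TriangularBasis G
  triangularBasis zero    G D≢0 units = record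
    { vectors = λ () ; triangular = tt ; vectors∈span = λ () ; span⊆span = λ _ _ → (λ ()) , λ () }
  triangularBasis (suc n) G D≢0 units = Extend.extended (triangularBasis n reduced D≢0 reduced-units)
    where open HermiteStep G D≢0 units

  private
    square-parityℕ : ∀ n → ∃ λ w → + n * + n ≡ + n + + 2 * w
    square-parityℕ zero    = + 0 , refl
    square-parityℕ (suc n) with square-parityℕ n
    ... | w , eq = w + + n , (begin
      (+ 1 + + n) * (+ 1 + + n)          ≡⟨ expand (+ n) ⟩
      + 1 + + 2 * + n + + n * + n        ≡⟨ cong (_+_ (+ 1 + + 2 * + n)) eq ⟩
      + 1 + + 2 * + n + (+ n + + 2 * w)  ≡⟨ regroup (+ n) w ⟩
      (+ 1 + + n) + + 2 * (w + + n)      ∎)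
      where
      expand : ∀ m → (+ 1 + m) * (+ 1 + m) ≡ + 1 + + 2 * m + m * m
      expand = solve-∀
      regroup : ∀ m w → + 1 + + 2 * m + (m + + 2 * w) ≡ (+ 1 + m) + + 2 * (w + m)
      regroup = solve-∀

  square-parity : ∀ a → ∃ λ w → a * a ≡ a + + 2 * w
  square-parity (+ n)    = square-parityℕ n
  square-parity -[1+ n ] with square-parityℕ (suc n)
  ... | w , eq = w + + suc n , trans (neg*neg (+ suc n)) (trans eq (regroup (+ suc n) w))
    where
    neg*neg : ∀ b → (- b) * (- b) ≡ b * b
    neg*neg = solve-∀
    regroup : ∀ b w → b + + 2 * w ≡ - b + + 2 * (w + b)
    regroup = solve-∀

  trace-square-parity : ∀ n (A : Fin n → Fin n → ℤ) → ∃ λ w → ℤL.trace (A ℤL.⊛ A) ≡ ℤL.trace A + + 2 * w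
  trace-square-parity zero    A = + 0 , refl
  trace-square-parity (suc n) A with square-parity (A zero zero) | trace-square-parity n (λ k l → A (suc k) (suc l))
  ... | w₀ , eq₀ | w′ , eq′ = w₀ + P + w′ , (begin
      (a * a + P) + ∑[ k < n ] (c k * r k + ∑[ l < n ] (A′ k l * A′ l k))
        ≡⟨ cong (_+_ (a * a + P)) (ℤL.∑-distrib-+ {n} (λ k → c k * r k) (λ k → ∑[ l < n ] (A′ k l * A′ l k))) ⟩
      (a * a + P) + (∑[ k < n ] (c k * r k) + ∑[ k < n ] ∑[ l < n ] (A′ k l * A′ l k))
        ≡⟨ cong₂ (λ x y → (x + P) + y) eq₀ (cong₂ _+_ (ℤL.sum-cong-≋ {n} (λ k → ℤP.*-comm (c k) (r k))) eq′) ⟩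
      (a + + 2 * w₀ + P) + (P + (ℤL.trace A′ + + 2 * w′))
        ≡⟨ regroup a P (ℤL.trace A′) w₀ w′ ⟩
      (a + ℤL.trace A′) + + 2 * (w₀ + P + w′) ∎)
    where
    a = A zero zero
    r c : Fin n → ℤ
    r l = A zero (suc l)
    c k = A (suc k) zero
    A′ : Fin n → Fin n → ℤ
    A′ k l = A (suc k) (suc l)
    P = ∑[ l < n ] (r l * c l)
    regroup : ∀ a P t w₀ w′ → (a + + 2 * w₀ + P) + (P + (t + + 2 * w′)) ≡ (a + t) + + 2 * (w₀ + P + w′)
    regroup = solve-∀

  2∣-shift : ∀ t w → (∃ λ k → t + + 2 * w ≡ + 2 * k) ⇔ (+ 2 ℤ.∣ t)
  2∣-shift t w = mk⇔
    (λ (k , eq) → ℤ.∣m+n∣n⇒∣m (divides k (trans eq (ℤP.*-comm (+ 2) k))) 2∣2w)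
    (λ 2∣t → let divides k eq = ℤ.∣m∣n⇒∣m+n 2∣t 2∣2w in k , trans eq (ℤP.*-comm k (+ 2)))
    where
    2∣2w : + 2 ℤ.∣ + 2 * w
    2∣2w = ℤ.∣m⇒∣m*n w ℤ.∣-refl

module RationalLinearAlgebra where

  open import Data.Integer as ℤ using (ℤ; 1ℤ)
  open import Data.Integer.Tactic.RingSolver using (solve-∀)
  open import Data.Rational as ℚ using (ℚ; mkℚ; 0ℚ; 1ℚ; _+_; _*_; -_; _-_; 1/_)
  import Data.Rational.Unnormalised as ℚᵘ
  import Data.Rational.Unnormalised.Properties as ℚᵘP
  open import Data.Bool using (true; false)
  import Data.Fin.Properties as FinP
  open import Relation.Binary.PropositionalEquality
  open import Relation.Nullary using (does)
  open ≡-Reasoning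
  open ℚL using (sum-syntax; linComb; δ; Triangular; ScaledUnitsInSpan; _⊛_; trace)

  private
    toℚᵘ-toℚ : ∀ z → ℚ.toℚᵘ (toℚ z) ℚᵘ.≃ ℚᵘ.mkℚᵘ z 0
    toℚᵘ-toℚ z = ℚP.toℚᵘ-fromℚᵘ (ℚᵘ.mkℚᵘ z 0)

    *1 : ∀ a → a ℤ.* 1ℤ ≡ a
    *1 = ℤP.*-identityʳ

  toℚ-+ : ∀ a b → toℚ (a ℤ.+ b) ≡ toℚ a + toℚ b
  toℚ-+ a b = ℚP.toℚᵘ-injective (ℚᵘP.≃-trans (toℚᵘ-toℚ (a ℤ.+ b)) (ℚᵘP.≃-trans (ℚᵘ.*≡* (distrib a b))
    (ℚᵘP.≃-sym (ℚᵘP.≃-trans (ℚP.toℚᵘ-homo-+ (toℚ a) (toℚ b)) (ℚᵘP.+-cong (toℚᵘ-toℚ a) (toℚᵘ-toℚ b))))))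
    where
    distrib : ∀ a b → (a ℤ.+ b) ℤ.* 1ℤ ≡ (a ℤ.* 1ℤ ℤ.+ b ℤ.* 1ℤ) ℤ.* 1ℤ
    distrib = solve-∀

  toℚ-* : ∀ a b → toℚ (a ℤ.* b) ≡ toℚ a * toℚ b
  toℚ-* a b = ℚP.toℚᵘ-injective (ℚᵘP.≃-trans (toℚᵘ-toℚ (a ℤ.* b))
    (ℚᵘP.≃-sym (ℚᵘP.≃-trans (ℚP.toℚᵘ-homo-* (toℚ a) (toℚ b)) (ℚᵘP.*-cong (toℚᵘ-toℚ a) (toℚᵘ-toℚ b)))))

  toℚ-neg : ∀ a → toℚ (ℤ.- a) ≡ - toℚ a
  toℚ-neg a = ℚP.toℚᵘ-injective (ℚᵘP.≃-trans (toℚᵘ-toℚ (ℤ.- a))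
    (ℚᵘP.≃-sym (ℚᵘP.≃-trans (ℚP.toℚᵘ-homo‿- (toℚ a)) (ℚᵘP.-‿cong (toℚᵘ-toℚ a)))))

  toℚ-injective : ∀ {a b} → toℚ a ≡ toℚ b → a ≡ b
  toℚ-injective {a} {b} eq with ℚᵘP.≃-trans (ℚᵘP.≃-sym (toℚᵘ-toℚ a)) (ℚᵘP.≃-trans (ℚP.toℚᵘ-cong eq) (toℚᵘ-toℚ b))
  ... | ℚᵘ.*≡* a*1≡b*1 = trans (sym (*1 a)) (trans a*1≡b*1 (*1 b))

  toℚ-∑ : ∀ n (f : Fin n → ℤ) → toℚ (ℤL.sum f) ≡ ∑[ i < n ] toℚ (f i)
  toℚ-∑ zero    f = refl
  toℚ-∑ (suc n) f = trans (toℚ-+ (f zero) _) (cong (_+_ (toℚ (f zero))) (toℚ-∑ n (f ∘ suc)))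

  toℚ-linComb : ∀ {N n} (c : Fin N → ℤ) (G : Fin N → Fin n → ℤ) i →
    toℚ (ℤL.linComb c G i) ≡ linComb (toℚ ∘ c) (λ r → toℚ ∘ G r) i
  toℚ-linComb {N} c G i = trans (toℚ-∑ N _) (ℚL.sum-cong-≋ {N} (λ r → toℚ-* (c r) (G r i)))

  toℚ-δ : ∀ {n} (i j : Fin n) → toℚ (ℤL.δ i j) ≡ δ i j
  toℚ-δ i j with does (i FinP.≟ j)
  ... | true  = refl
  ... | false = refl

  toℚ-triangular : ∀ n (β : Fin n → Fin n → ℤ) → ℤL.Triangular n β → Triangular n (λ k → toℚ ∘ β k)
  toℚ-triangular zero    β _ = _
  toℚ-triangular (suc n) β (β₀₀≢0 , column₀ , rest) =
    (β₀₀≢0 ∘ toℚ-injective) , (cong toℚ ∘ column₀) , toℚ-triangular n (λ k i → β (suc k) (suc i)) rest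

  ∑≡sum : ∀ n (f : Fin n → ℚ) → ∑ n f ≡ ∑[ i < n ] f i
  ∑≡sum zero    f = refl
  ∑≡sum (suc n) f = cong (_+_ (f zero)) (∑≡sum n (f ∘ suc))

  *-cancelʳ : ∀ a b c → c ≢ 0ℚ → a * c ≡ b * c → a ≡ b
  *-cancelʳ a b c c≢0 eq = begin
    a                  ≡⟨ ℚP.*-identityʳ a ⟨
    a * 1ℚ             ≡⟨ cong (a *_) (ℚP.*-inverseʳ c) ⟨
    a * (c * 1/ c)     ≡⟨ ℚP.*-assoc a c _ ⟨
    a * c * 1/ c       ≡⟨ cong (_* 1/ c) eq ⟩
    b * c * 1/ c       ≡⟨ ℚP.*-assoc b c _ ⟩
    b * (c * 1/ c)     ≡⟨ cong (b *_) (ℚP.*-inverseʳ c) ⟩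
    b * 1ℚ             ≡⟨ ℚP.*-identityʳ b ⟩
    b                  ∎
    where instance _ = ℚ.≢-nonZero c≢0

  triangular-independent : ∀ n (b : Fin n → Vecℚ n) → Triangular n b →
    ∀ q → (∀ j → linComb q b j ≡ 0ℚ) → ∀ k → q k ≡ 0ℚ
  triangular-independent (suc n) b (b₀₀≢0 , column₀ , rest) q q⊛b≡0 = q≡0
    where
    b′ : Fin n → Vecℚ n
    b′ k i = b (suc k) (suc i)
    q′ : Fin n → ℚ
    q′ = q ∘ suc
    tail-vanishes : ∑[ k < n ] (q′ k * b (suc k) zero) ≡ 0ℚ
    tail-vanishes = trans (ℚL.sum-cong-≋ {n} (λ k → trans (cong (q′ k *_) (column₀ k)) (ℚP.*-zeroʳ (q′ k)))) (ℚL.sum-replicate-zero n)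
    q₀≡0 : q zero ≡ 0ℚ
    q₀≡0 = *-cancelʳ (q zero) 0ℚ (b zero zero) b₀₀≢0 (begin
      q zero * b zero zero                                         ≡⟨ ℚP.+-identityʳ _ ⟨
      q zero * b zero zero + 0ℚ                                    ≡⟨ cong (q zero * b zero zero +_) tail-vanishes ⟨
      q zero * b zero zero + ∑[ k < n ] (q′ k * b (suc k) zero) ≡⟨ q⊛b≡0 zero ⟩
      0ℚ                                                           ≡⟨ ℚP.*-zeroˡ (b zero zero) ⟨
      0ℚ * b zero zero                                             ∎)
    q′⊛b′≡0 : ∀ j → linComb q′ b′ j ≡ 0ℚ
    q′⊛b′≡0 j = begin
      linComb q′ b′ j                            ≡⟨ ℚP.+-identityˡ _ ⟨
      0ℚ + linComb q′ b′ j                       ≡⟨ cong (_+ linComb q′ b′ j) (ℚP.*-zeroˡ (b zero (suc j))) ⟨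
      0ℚ * b zero (suc j) + linComb q′ b′ j      ≡⟨ cong (λ z → z * b zero (suc j) + linComb q′ b′ j) q₀≡0 ⟨
      q zero * b zero (suc j) + linComb q′ b′ j  ≡⟨ q⊛b≡0 (suc j) ⟩
      0ℚ                                         ∎
    q≡0 : ∀ k → q k ≡ 0ℚ
    q≡0 zero    = q₀≡0
    q≡0 (suc k) = triangular-independent n b′ rest q′ q′⊛b′≡0 k

  scaled-inverseʳ : ∀ {n} (b C : Fin n → Vecℚ n) → Triangular n b → ∀ D →
    (∀ i j → D * δ i j ≡ (C ⊛ b) i j) → ∀ l k → (b ⊛ C) l k ≡ D * δ l k
  scaled-inverseʳ {n} b C triangular D C⊛b≡D l k =
    x∙y⁻¹≈ε⇒x≈y _ _ (triangular-independent n b triangular (λ k → (b ⊛ C) l k - D * δ l k) vanishes k)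
    where
    open import Algebra.Properties.Group ℚP.+-0-group using (x∙y⁻¹≈ε⇒x≈y)
    b⊛C⊛b≡D : ∀ j → linComb ((b ⊛ C) l) b j ≡ D * b l j
    b⊛C⊛b≡D j = begin
      linComb ((b ⊛ C) l) b j              ≡⟨ ℚL.linComb-⊛ (b l) C b j ⟨
      linComb (b l) (C ⊛ b) j              ≡⟨ ℚL.linComb-congʳ (b l) (λ i j → sym (C⊛b≡D i j)) j ⟩
      linComb (b l) (λ i j → D * δ i j) j  ≡⟨ ℚL.linComb-scaledUnits (b l) D j ⟩
      D * b l j                            ∎
    vanishes : ∀ j → linComb (λ k → (b ⊛ C) l k - D * δ l k) b j ≡ 0ℚ
    vanishes j = begin
      linComb (λ k → (b ⊛ C) l k - D * δ l k) b j               ≡⟨ ℚL.linComb-sub ((b ⊛ C) l) (λ k → D * δ l k) b j ⟩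
      linComb ((b ⊛ C) l) b j - linComb (λ k → D * δ l k) b j   ≡⟨ cong₂ _-_ (b⊛C⊛b≡D j) (ℚL.linComb-δ D l b j) ⟩
      D * b l j - D * b l j                                     ≡⟨ ℚP.+-inverseʳ (D * b l j) ⟩
      0ℚ                                                        ∎

  record IsLinear {n} (φ : Vecℚ n → Vecℚ n) : Set where
    field
      preserves-≈       : ∀ {v w} → v ≈ w → φ v ≈ φ w
      preserves-linComb : ∀ {N} (a : Fin N → ℚ) (u : Fin N → Vecℚ n) → φ (linComb a u) ≈ linComb a (φ ∘ u)

  matrixOf : ∀ {n} → (Vecℚ n → Vecℚ n) → Fin n → Fin n → ℚ
  matrixOf φ i = φ (δ i)

  module _ {n} {φ : Vecℚ n → Vecℚ n} (linear : IsLinear φ) where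
    open IsLinear linear

    preserves-scale : ∀ a v → φ (λ t → a * v t) ≈ (λ t → a * φ v t)
    preserves-scale a v j = begin
      φ (λ t → a * v t) j                        ≡⟨ preserves-≈ (λ t → ℚP.+-identityʳ (a * v t)) j ⟨
      φ (linComb {1} (λ _ → a) (λ _ → v)) j      ≡⟨ preserves-linComb {1} (λ _ → a) (λ _ → v) j ⟩
      a * φ v j + 0ℚ                             ≡⟨ ℚP.+-identityʳ (a * φ v j) ⟩
      a * φ v j                                  ∎

    ∘-linear : IsLinear (φ ∘ φ)
    ∘-linear = record
      { preserves-≈       = preserves-≈ ∘ preserves-≈
      ; preserves-linComb = λ a u j → trans (preserves-≈ (preserves-linComb a u) j) (preserves-linComb a (φ ∘ u) j)
      }

    matrix-∘ : ∀ (b : Fin n → Vecℚ n) A → (∀ k → φ (b k) ≈ (A ⊛ b) k) → ∀ k → φ (φ (b k)) ≈ (A ⊛ A ⊛ b) k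
    matrix-∘ b A φb≈A⊛b k j = begin
      φ (φ (b k)) j                 ≡⟨ preserves-≈ (φb≈A⊛b k) j ⟩
      φ ((A ⊛ b) k) j               ≡⟨ preserves-linComb (A k) b j ⟩
      linComb (A k) (φ ∘ b) j       ≡⟨ ℚL.linComb-congʳ (A k) φb≈A⊛b j ⟩
      linComb (A k) (A ⊛ b) j       ≡⟨ ℚL.linComb-⊛ (A k) A b j ⟩
      (A ⊛ A ⊛ b) k j               ∎

    -- C ⊛ b = D·I forces b ⊛ C = D·I, hence D · tr φ = tr (C ⊛ (A ⊛ b)) = tr (A ⊛ (b ⊛ C)) = D · tr A.
    trace-in-basis : (b : Fin n → Vecℚ n) → Triangular n b → ∀ {D} → D ≢ 0ℚ → ScaledUnitsInSpan D b →
      ∀ A → (∀ k → φ (b k) ≈ (A ⊛ b) k) → trace (matrixOf φ) ≡ trace A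
    trace-in-basis b triangular {D} D≢0 units A φb≈A⊛b =
      *-cancelʳ _ _ D D≢0 (trans (ℚP.*-comm _ D) (trans D*trace (ℚP.*-comm D _)))
      where
      C : Fin n → Fin n → ℚ
      C i = proj₁ (units i)
      C⊛b≡D : ∀ i j → D * δ i j ≡ (C ⊛ b) i j
      C⊛b≡D i = proj₂ (units i)

      rows : ∀ i j → D * matrixOf φ i j ≡ (C ⊛ (A ⊛ b)) i j
      rows i j = begin
        D * φ (δ i) j                        ≡⟨ ℚL.linComb-δ D i (φ ∘ δ) j ⟨
        linComb (λ r → D * δ i r) (φ ∘ δ) j  ≡⟨ preserves-linComb (λ r → D * δ i r) δ j ⟨
        φ (linComb (λ r → D * δ i r) δ) j    ≡⟨ preserves-≈ (λ j′ → trans (ℚL.linComb-δ D i δ j′) (C⊛b≡D i j′)) j ⟩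
        φ ((C ⊛ b) i) j                      ≡⟨ preserves-linComb (C i) b j ⟩
        linComb (C i) (φ ∘ b) j              ≡⟨ ℚL.linComb-congʳ (C i) φb≈A⊛b j ⟩
        (C ⊛ (A ⊛ b)) i j                    ∎

      D*trace : D * trace (matrixOf φ) ≡ D * trace A
      D*trace = begin
        D * trace (matrixOf φ)            ≡⟨ ℚL.*-distribˡ-sum {n} D (λ i → matrixOf φ i i) ⟩
        ∑[ i < n ] (D * matrixOf φ i i)   ≡⟨ ℚL.sum-cong-≋ {n} (λ i → rows i i) ⟩
        trace (C ⊛ (A ⊛ b))               ≡⟨ ℚL.trace-⊛-comm C (A ⊛ b) ⟩
        trace (A ⊛ b ⊛ C)                 ≡⟨ ℚL.sum-cong-≋ {n} (λ k → ℚL.linComb-⊛ (A k) b C k) ⟨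
        trace (A ⊛ (b ⊛ C))               ≡⟨ ℚL.sum-cong-≋ {n} (λ k → ℚL.linComb-congʳ (A k) (scaled-inverseʳ b C triangular D C⊛b≡D) k) ⟩
        ∑[ k < n ] linComb (A k) (λ l m → D * δ l m) k ≡⟨ ℚL.sum-cong-≋ {n} (λ k → ℚL.linComb-scaledUnits (A k) D k) ⟩
        ∑[ k < n ] (D * A k k)            ≡⟨ ℚL.*-distribˡ-sum {n} D (λ k → A k k) ⟨
        D * trace A                       ∎

  ClearedBy : ℕ → ℚ → Set
  ClearedBy D q = ∃ λ z → toℚ (ℤ.+ D) * q ≡ toℚ z

  denominator : ∀ q → ∃ λ D → ClearedBy (suc D) q
  denominator q@(mkℚ z k _) = k , z , ℚP.toℚᵘ-injective
    (ℚᵘP.≃-trans (ℚP.toℚᵘ-homo-* (toℚ (ℤ.+ suc k)) q) (ℚᵘP.≃-trans (ℚᵘP.*-congʳ (toℚᵘ-toℚ (ℤ.+ suc k)))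
      (ℚᵘP.≃-trans (ℚᵘ.*≡* (cross (ℤ.+ suc k) z)) (ℚᵘP.≃-sym (toℚᵘ-toℚ z)))))
    where
    cross : ∀ a b → (a ℤ.* b) ℤ.* 1ℤ ≡ b ℤ.* (1ℤ ℤ.* a)
    cross = solve-∀

  clearedBy-* : ∀ M {D q} → ClearedBy D q → ClearedBy (M ℕ.* D) q
  clearedBy-* M {D} {q} (z , Dq≡z) = ℤ.+ M ℤ.* z , (begin
    toℚ (ℤ.+ (M ℕ.* D)) * q            ≡⟨ cong (λ a → toℚ a * q) (ℤP.pos-* M D) ⟩
    toℚ (ℤ.+ M ℤ.* ℤ.+ D) * q          ≡⟨ cong (_* q) (toℚ-* (ℤ.+ M) (ℤ.+ D)) ⟩
    toℚ (ℤ.+ M) * toℚ (ℤ.+ D) * q      ≡⟨ ℚP.*-assoc (toℚ (ℤ.+ M)) (toℚ (ℤ.+ D)) q ⟩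
    toℚ (ℤ.+ M) * (toℚ (ℤ.+ D) * q)    ≡⟨ cong (toℚ (ℤ.+ M) *_) Dq≡z ⟩
    toℚ (ℤ.+ M) * toℚ z                ≡⟨ toℚ-* (ℤ.+ M) z ⟨
    toℚ (ℤ.+ M ℤ.* z)                  ∎)
    where open ≡-Reasoning

  common-multiple : ∀ N (P : Fin N → ℕ → Set) → (∀ r M {D} → P r D → P r (M ℕ.* D)) →
    (∀ r → ∃ λ D → P r (suc D)) → ∃ λ D → ∀ r → P r (suc D)
  common-multiple zero    P P-* single = 0 , λ ()
  common-multiple (suc N) P P-* single with single zero | common-multiple N (P ∘ suc) (P-* ∘ suc) (single ∘ suc)
  ... | a , P₀ | b , Pₛ = b ℕ.+ a ℕ.* suc b , multiple
    where
    multiple : ∀ r → P r (suc a ℕ.* suc b)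
    multiple zero    = subst (P zero) (ℕP.*-comm (suc b) (suc a)) (P-* zero (suc b) P₀)
    multiple (suc r) = P-* (suc r) (suc a) (Pₛ r)

  common-denominator : ∀ {N n} (P : Fin N → Fin n → ℚ) → ∃ λ D → ∀ r t → ClearedBy (suc D) (P r t)
  common-denominator {N} {n} P = common-multiple N (λ r D → ∀ t → ClearedBy D (P r t)) (λ r M c t → clearedBy-* M (c t))
    (λ r → common-multiple n (λ t D → ClearedBy D (P r t)) (λ t M → clearedBy-* M) (λ t → denominator (P r t)))

module LatticeTraces where

  open import Data.Integer as ℤ using (ℤ)
  open import Data.Rational as ℚ using (ℚ; 0ℚ; _*_)
  open import Relation.Binary.PropositionalEquality
  open IntegerLattices
  open RationalLinearAlgebra
  open ≡-Reasoning
  open ℚL using (sum-syntax; linComb; δ; trace; _⊛_)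

  InℤSpan : ∀ {N n} → (Fin N → Vecℚ n) → Vecℚ n → Set
  InℤSpan {N} P v = ∃ λ (c : Fin N → ℤ) → v ≈ linComb (toℚ ∘ c) P

  module _ {N n} (P : Fin N → Vecℚ n) where

    InℤSpan-resp-≈ : ∀ {v w} → v ≈ w → InℤSpan P w → InℤSpan P v
    InℤSpan-resp-≈ v≈w (c , w≈cP) = c , λ t → trans (v≈w t) (w≈cP t)

    generator∈span : ∀ s → InℤSpan P (P s)
    generator∈span s = ℤL.δ s , λ t → sym (begin
      linComb (toℚ ∘ ℤL.δ s) P t   ≡⟨ ℚL.sum-cong-≋ {N} (λ r → cong (_* P r t) (toℚ-δ s r)) ⟩
      linComb (δ s) P t            ≡⟨ ℚL.∑-δˡ N s (λ r → P r t) ⟩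
      P s t                        ∎)

    subfamily∈span : ∀ {M} (f : Fin M → Fin N) (a : Fin M → ℤ) → InℤSpan P (linComb (toℚ ∘ a) (P ∘ f))
    subfamily∈span {M} f a = ℤL.linComb a (ℤL.δ ∘ f) , λ t → sym (begin
      linComb (toℚ ∘ ℤL.linComb a (ℤL.δ ∘ f)) P t     ≡⟨ ℚL.sum-cong-≋ {N} (λ r → cong (_* P r t) (toℚ-coefficients r)) ⟩
      linComb (linComb (toℚ ∘ a) (δ ∘ f)) P t          ≡⟨ ℚL.linComb-⊛ (toℚ ∘ a) (δ ∘ f) P t ⟨
      linComb (toℚ ∘ a) ((δ ∘ f) ⊛ P) t                ≡⟨ ℚL.linComb-congʳ (toℚ ∘ a) (λ m t → ℚL.∑-δˡ N (f m) (λ r → P r t)) t ⟩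
      linComb (toℚ ∘ a) (P ∘ f) t                      ∎)
      where
      toℚ-coefficients : ∀ r → toℚ (ℤL.linComb a (ℤL.δ ∘ f) r) ≡ linComb (toℚ ∘ a) (δ ∘ f) r
      toℚ-coefficients r = trans (toℚ-linComb a (ℤL.δ ∘ f) r) (ℚL.sum-cong-≋ {M} (λ m → cong (toℚ (a m) *_) (toℚ-δ (f m) r)))

  -- D is a parameter rather than the computed common denominator: normalising toℚ of a concrete
  -- suc-term makes the type checker evaluate gcds, which is prohibitively slow.
  module ClearedLattice {N n} {φ : Vecℚ n → Vecℚ n} (linear : IsLinear φ) (P : Fin N → Vecℚ n)
      (units : ∀ j → InℤSpan P (δ j)) (stable : ∀ s → InℤSpan P (φ (P s)))
      (D : ℕ) (D≢0 : D ≢ 0) (G : Fin N → Fin n → ℤ) (DP≡G : ∀ s t → toℚ (ℤ.+ D) * P s t ≡ toℚ (G s t)) where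

    open IsLinear linear

    Dℚ : ℚ
    Dℚ = toℚ (ℤ.+ D)

    scaled-span : ∀ v → InℤSpan P v → ∃ λ c → ∀ i → Dℚ * v i ≡ toℚ (ℤL.linComb c G i)
    scaled-span v (c , v≈cP) = c , λ i → begin
      Dℚ * v i                                  ≡⟨ cong (Dℚ *_) (v≈cP i) ⟩
      Dℚ * linComb (toℚ ∘ c) P i                ≡⟨ ℚL.linComb-scaleʳ Dℚ (toℚ ∘ c) P i ⟨
      linComb (toℚ ∘ c) (λ r t → Dℚ * P r t) i  ≡⟨ ℚL.linComb-congʳ (toℚ ∘ c) DP≡G i ⟩
      linComb (toℚ ∘ c) (λ r → toℚ ∘ G r) i     ≡⟨ toℚ-linComb c G i ⟨
      toℚ (ℤL.linComb c G i)                    ∎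

    units-G : ℤL.ScaledUnitsInSpan (ℤ.+ D) G
    units-G j with scaled-span (δ j) (units j)
    ... | c , Dδ≡cG = c , λ i → toℚ-injective {ℤ.+ D ℤ.* ℤL.δ j i} {ℤL.linComb c G i} (begin
      toℚ (ℤ.+ D ℤ.* ℤL.δ j i)   ≡⟨ toℚ-* (ℤ.+ D) (ℤL.δ j i) ⟩
      Dℚ * toℚ (ℤL.δ j i)        ≡⟨ cong (Dℚ *_) (toℚ-δ j i) ⟩
      Dℚ * δ j i                 ≡⟨ Dδ≡cG i ⟩
      toℚ (ℤL.linComb c G i)     ∎)

    generators-stable : ∀ s → ∃ λ w → ∀ i → φ (toℚ ∘ G s) i ≡ toℚ (ℤL.linComb w G i)
    generators-stable s with scaled-span (φ (P s)) (stable s)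
    ... | w , Dφ≡wG = w , λ i → trans (preserves-≈ (λ t → sym (DP≡G s t)) i) (trans (preserves-scale linear Dℚ (P s) i) (Dφ≡wG i))

    W : Fin N → Fin N → ℤ
    W s = proj₁ (generators-stable s)

    lattice-stable : ∀ c i → φ (toℚ ∘ ℤL.linComb c G) i ≡ toℚ (ℤL.linComb (ℤL.linComb c W) G i)
    lattice-stable c i = begin
      φ (toℚ ∘ ℤL.linComb c G) i                                   ≡⟨ preserves-≈ (toℚ-linComb c G) i ⟩
      φ (linComb (toℚ ∘ c) (λ r → toℚ ∘ G r)) i                    ≡⟨ preserves-linComb (toℚ ∘ c) (λ r → toℚ ∘ G r) i ⟩
      linComb (toℚ ∘ c) (λ r → φ (toℚ ∘ G r)) i                    ≡⟨ ℚL.linComb-congʳ (toℚ ∘ c) (λ r → proj₂ (generators-stable r)) i ⟩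
      linComb (toℚ ∘ c) (λ r → toℚ ∘ ℤL.linComb (W r) G) i        ≡⟨ toℚ-linComb c (λ r → ℤL.linComb (W r) G) i ⟨
      toℚ (ℤL.linComb c (λ r → ℤL.linComb (W r) G) i)              ≡⟨ cong toℚ reassociate ⟩
      toℚ (ℤL.linComb (ℤL.linComb c W) G i)                        ∎
      where
      reassociate : ℤL.linComb c (λ r → ℤL.linComb (W r) G) i ≡ ℤL.linComb (ℤL.linComb c W) G i
      reassociate = ℤL.linComb-⊛ c W G i

    Dℤ≢0 : ℤ.+ D ≢ ℤ.+ 0
    Dℤ≢0 = D≢0 ∘ ℤP.+-injective

    Dℚ≢0 : Dℚ ≢ 0ℚ
    Dℚ≢0 = Dℤ≢0 ∘ toℚ-injective {ℤ.+ D} {ℤ.+ 0}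

    private
      module B = TriangularBasis (triangularBasis n G Dℤ≢0 units-G)

    b : Fin n → Vecℚ n
    b k = toℚ ∘ B.vectors k

    in-basis : ∀ v → ℤL.InSpan G v → ∃ λ c → ∀ i → toℚ (v i) ≡ linComb (toℚ ∘ c) b i
    in-basis v v∈G = c , λ i → trans (cong toℚ (v≡cβ i)) (toℚ-linComb c B.vectors i)
      where
      c = proj₁ (B.span⊆span v v∈G)
      v≡cβ = proj₂ (B.span⊆span v v∈G)

    private
      image-coefficients : Fin n → Fin N → ℤ
      image-coefficients k = ℤL.linComb (proj₁ (B.vectors∈span k)) W

      image-in-basis : ∀ k → ∃ λ c → ∀ i → toℚ (ℤL.linComb (image-coefficients k) G i) ≡ linComb (toℚ ∘ c) b i
      image-in-basis k = in-basis (ℤL.linComb (image-coefficients k) G) (image-coefficients k , λ _ → refl)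

    A : Fin n → Fin n → ℤ
    A k = proj₁ (image-in-basis k)

    Aℚ : Fin n → Fin n → ℚ
    Aℚ k l = toℚ (A k l)

    φb≈Ab : ∀ k → φ (b k) ≈ (Aℚ ⊛ b) k
    φb≈Ab k i = begin
      φ (toℚ ∘ B.vectors k) i                        ≡⟨ preserves-≈ (cong toℚ ∘ β≡cG) i ⟩
      φ (toℚ ∘ ℤL.linComb c G) i                     ≡⟨ lattice-stable c i ⟩
      toℚ (ℤL.linComb (ℤL.linComb c W) G i)          ≡⟨ proj₂ (image-in-basis k) i ⟩
      linComb (Aℚ k) b i                             ∎
      where
      c = proj₁ (B.vectors∈span k)
      β≡cG = proj₂ (B.vectors∈span k)

    units-b : ℚL.ScaledUnitsInSpan Dℚ b
    units-b j = toℚ ∘ proj₁ Dδ∈b , λ i → trans (sym (Dδ i)) (proj₂ Dδ∈b i)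
      where
      Dδ∈b = in-basis (λ i → ℤ.+ D ℤ.* ℤL.δ j i) (units-G j)
      Dδ : ∀ i → toℚ (ℤ.+ D ℤ.* ℤL.δ j i) ≡ Dℚ * δ j i
      Dδ i = trans (toℚ-* (ℤ.+ D) (ℤL.δ j i)) (cong (Dℚ *_) (toℚ-δ j i))

    triangular-b : ℚL.Triangular n b
    triangular-b = toℚ-triangular n B.vectors B.triangular

    trace-φ : trace (matrixOf φ) ≡ toℚ (ℤL.trace A)
    trace-φ = trans (trace-in-basis linear b triangular-b Dℚ≢0 units-b Aℚ φb≈Ab) (sym (toℚ-∑ n (λ k → A k k)))

    trace-φ² : trace (matrixOf (φ ∘ φ)) ≡ toℚ (ℤL.trace (A ℤL.⊛ A))
    trace-φ² = trans (trace-in-basis (∘-linear linear) b triangular-b Dℚ≢0 units-b (Aℚ ⊛ Aℚ) (matrix-∘ linear b Aℚ φb≈Ab))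
                     (sym toℚ-trace-A²)
      where
      toℚ-trace-A² : toℚ (ℤL.trace (A ℤL.⊛ A)) ≡ trace (Aℚ ⊛ Aℚ)
      toℚ-trace-A² = trans (toℚ-∑ n (λ k → ℤL.linComb (A k) A k)) (ℚL.sum-cong-≋ {n} (λ k → toℚ-linComb (A k) A k))

  trace-parity : ∀ {N n} {φ : Vecℚ n → Vecℚ n} → IsLinear φ → (P : Fin N → Vecℚ n) →
    (∀ j → InℤSpan P (δ j)) → (∀ s → InℤSpan P (φ (P s))) →
    ∃₂ λ t w → trace (matrixOf φ) ≡ toℚ t × trace (matrixOf (φ ∘ φ)) ≡ toℚ (t ℤ.+ ℤ.+ 2 ℤ.* w)
  trace-parity {N} {n} linear P units stable = ℤL.trace A , proj₁ parity , trace-φ , trans trace-φ² (cong toℚ (proj₂ parity))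
    where
    D′ = proj₁ (common-denominator P)
    cleared = proj₂ (common-denominator P)
    G : Fin N → Fin n → ℤ
    G s t = proj₁ (cleared s t)
    DP≡G : ∀ s t → toℚ (ℤ.+ suc D′) ℚ.* P s t ≡ toℚ (G s t)
    DP≡G s t = proj₂ (cleared s t)
    D≢0 : suc D′ ≢ 0
    D≢0 ()
    open ClearedLattice linear P units stable (suc D′) D≢0 G DP≡G
    parity = trace-square-parity n A

module NumberFieldTraces where

  open import Data.Integer as ℤ using (ℤ)
  open import Data.Rational as ℚ using (ℚ; _+_; _*_; -_)
  open import Data.Fin using (toℕ; fromℕ<; combine; remQuot)
  import Data.Fin
  import Data.Fin.Properties as FinP
  open import Data.List using (List; []; _∷_; length; lookup)
  open import Data.Empty using (⊥-elim)
  open import Relation.Nullary using (Dec; yes; no)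
  open import Relation.Binary.PropositionalEquality
  open RationalLinearAlgebra
  open LatticeTraces
  open ≡-Reasoning
  open ℚL using (sum-syntax; linComb; δ; trace; _⊛_)

  module _ {n} (c : Fin n → Fin n → Fin n → ℚ) where

    mulSC-as-linCombʳ : ∀ x y k → mulSC c x y k ≡ linComb y (λ j k → ∑[ i < n ] (x i * c i j k)) k
    mulSC-as-linCombʳ x y k = begin
      mulSC c x y k                                   ≡⟨ trans (∑≡sum n _) (ℚL.sum-cong-≋ {n} (λ i → ∑≡sum n _)) ⟩
      ∑[ i < n ] ∑[ j < n ] (x i * y j * c i j k)     ≡⟨ ℚL.∑-comm {n} {n} (λ i j → x i * y j * c i j k) ⟩
      ∑[ j < n ] ∑[ i < n ] (x i * y j * c i j k)
        ≡⟨ ℚL.sum-cong-≋ {n} (λ j → trans (ℚL.sum-cong-≋ {n} (λ i → regroup (x i) (y j) (c i j k))) (sym (ℚL.*-distribˡ-sum {n} (y j) (λ i → x i * c i j k)))) ⟩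
      ∑[ j < n ] (y j * ∑[ i < n ] (x i * c i j k))  ∎
      where
      regroup : ∀ a b e → a * b * e ≡ b * (a * e)
      regroup a b e = trans (cong (_* e) (ℚP.*-comm a b)) (ℚP.*-assoc b a e)

    mulSC-as-linCombˡ : ∀ x y k → mulSC c x y k ≡ linComb x (λ i k → ∑[ j < n ] (y j * c i j k)) k
    mulSC-as-linCombˡ x y k = begin
      mulSC c x y k                                   ≡⟨ trans (∑≡sum n _) (ℚL.sum-cong-≋ {n} (λ i → ∑≡sum n _)) ⟩
      ∑[ i < n ] ∑[ j < n ] (x i * y j * c i j k)
        ≡⟨ ℚL.sum-cong-≋ {n} (λ i → trans (ℚL.sum-cong-≋ {n} (λ j → ℚP.*-assoc (x i) (y j) (c i j k))) (sym (ℚL.*-distribˡ-sum {n} (x i) (λ j → y j * c i j k)))) ⟩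
      ∑[ i < n ] (x i * ∑[ j < n ] (y j * c i j k))  ∎

    mulSC-linearʳ : ∀ x → IsLinear (mulSC c x)
    mulSC-linearʳ x = record
      { preserves-≈       = λ {v} {w} v≈w k → trans (mulSC-as-linCombʳ x v k)
          (trans (ℚL.sum-cong-≋ {n} (λ j → cong (_* _) (v≈w j))) (sym (mulSC-as-linCombʳ x w k)))
      ; preserves-linComb = λ a u k → begin
          mulSC c x (linComb a u) k             ≡⟨ mulSC-as-linCombʳ x (linComb a u) k ⟩
          linComb (linComb a u) M k             ≡⟨ ℚL.linComb-⊛ a u M k ⟨
          linComb a (u ⊛ M) k                   ≡⟨ ℚL.linComb-congʳ a (λ r k → sym (mulSC-as-linCombʳ x (u r) k)) k ⟩
          linComb a (λ r → mulSC c x (u r)) k   ∎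
      }
      where
      M : Fin n → Fin n → ℚ
      M j k = ∑[ i < n ] (x i * c i j k)

    mulSC-congˡ : ∀ {x x′} y → x ≈ x′ → mulSC c x y ≈ mulSC c x′ y
    mulSC-congˡ {x} {x′} y x≈x′ k = trans (mulSC-as-linCombˡ x y k)
      (trans (ℚL.sum-cong-≋ {n} (λ i → cong (_* _) (x≈x′ i))) (sym (mulSC-as-linCombˡ x′ y k)))

    mulSC-linCombˡ : ∀ {N} (a : Fin N → ℚ) (u : Fin N → Vecℚ n) y → mulSC c (linComb a u) y ≈ linComb a (λ r → mulSC c (u r) y)
    mulSC-linCombˡ a u y k = begin
      mulSC c (linComb a u) y k             ≡⟨ mulSC-as-linCombˡ (linComb a u) y k ⟩
      linComb (linComb a u) M k             ≡⟨ ℚL.linComb-⊛ a u M k ⟨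
      linComb a (u ⊛ M) k                   ≡⟨ ℚL.linComb-congʳ a (λ r k → sym (mulSC-as-linCombˡ (u r) y k)) k ⟩
      linComb a (λ r → mulSC c (u r) y) k   ∎
      where
      M : Fin n → Fin n → ℚ
      M i k = ∑[ j < n ] (y j * c i j k)

  module _ (K : NumberField) where
    open NumberField K

    basis≈δ : ∀ i → basis K i ≈ δ i
    basis≈δ i j with i Data.Fin.≟ j
    ... | yes _ = refl
    ... | no  _ = refl

    Trace≡trace : ∀ x → Trace K x ≡ trace (matrixOf (x ·_))
    Trace≡trace x = trans (∑≡sum deg _) (ℚL.sum-cong-≋ {deg} (λ i → IsLinear.preserves-≈ (mulSC-linearʳ c x) (basis≈δ i) i))

    Trace-square≡trace : ∀ x → Trace K (x · x) ≡ trace (matrixOf ((x ·_) ∘ (x ·_)))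
    Trace-square≡trace x = trans (Trace≡trace (x · x)) (ℚL.sum-cong-≋ {deg} (λ i → ·-assoc x x (δ i) i))

    evalFrom≡linComb : ∀ x as k t → evalFrom K as x k t ≡ linComb (toℚ ∘ lookup as) (λ i → pow K x (k ℕ.+ toℕ i)) t
    evalFrom≡linComb x []       k t = refl
    evalFrom≡linComb x (a ∷ as) k t = cong₂ _+_ (cong (λ m → toℚ a * pow K x m t) (sym (ℕP.+-identityʳ k)))
      (trans (evalFrom≡linComb x as (suc k) t)
             (ℚL.sum-cong-≋ {length as} (λ i → cong (λ m → toℚ (lookup as i) * pow K x m t) (sym (ℕP.+-suc k (toℕ i))))))

    module PowerGenerators (x : Elt K) (a : ℤ) (as′ : List ℤ)
        (root : (pow K x (length (a ∷ as′)) ⊕ evalFrom K (a ∷ as′) x 0) ≈ zeroV) where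

      as : List ℤ
      as = a ∷ as′

      d : ℕ
      d = length as

      generator : Fin d × Fin deg → Elt K
      generator (i , j) = pow K x (toℕ i) · basis K j

      P : Fin (d ℕ.* deg) → Elt K
      P = generator ∘ remQuot deg

      P-combine : ∀ i j → P (combine i j) ≡ generator (i , j)
      P-combine i j = cong generator (FinP.remQuot-combine i j)

      top-power : pow K x d ≈ linComb (λ i → toℚ (ℤ.- lookup as i)) (λ i → pow K x (toℕ i))
      top-power t = begin
        pow K x d t                                                       ≡⟨ inverseˡ-unique _ _ (root t) ⟩
        - evalFrom K as x 0 t                                             ≡⟨ cong -_ (evalFrom≡linComb x as 0 t) ⟩
        - linComb (toℚ ∘ lookup as) (λ i → pow K x (toℕ i)) t              ≡⟨ ℚL.∑-neg d (λ i → toℚ (lookup as i) * pow K x (toℕ i) t) ⟨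
        ∑[ i < d ] (- (toℚ (lookup as i) * pow K x (toℕ i) t))            ≡⟨ ℚL.sum-cong-≋ {d} negate-coefficient ⟩
        linComb (λ i → toℚ (ℤ.- lookup as i)) (λ i → pow K x (toℕ i)) t   ∎
        where
        open import Algebra.Properties.Group ℚP.+-0-group using (inverseˡ-unique)
        negate-coefficient : ∀ i → - (toℚ (lookup as i) * pow K x (toℕ i) t) ≡ toℚ (ℤ.- lookup as i) * pow K x (toℕ i) t
        negate-coefficient i = trans (ℚP.neg-distribˡ-* (toℚ (lookup as i)) (pow K x (toℕ i) t))
                                     (cong (_* pow K x (toℕ i) t) (sym (toℚ-neg (lookup as i))))

      units : ∀ j → InℤSpan P (δ j)
      units j = InℤSpan-resp-≈ P δ≈P (generator∈span P (combine {d} zero j))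
        where
        δ≈P : δ j ≈ P (combine {d} zero j)
        δ≈P t = begin
          δ j t                      ≡⟨ basis≈δ j t ⟨
          basis K j t                ≡⟨ ·-unit (basis K j) t ⟨
          generator (zero , j) t     ≡⟨ cong (λ v → v t) (P-combine zero j) ⟨
          P (combine {d} zero j) t   ∎

      next-power : ∀ i j → (x · generator (i , j)) ≈ (pow K x (suc (toℕ i)) · basis K j)
      next-power i j t = sym (·-assoc x (pow K x (toℕ i)) (basis K j) t)

      -- x · x^i e_j is the next generator, except for i = d - 1, where the monic relation rewrites x^d.
      stable-at : ∀ i j → Dec (suc (toℕ i) ℕ.< d) → InℤSpan P (x · generator (i , j))
      stable-at i j (yes i+1<d) = InℤSpan-resp-≈ P x·P≈P (generator∈span P (combine {d} (fromℕ< i+1<d) j))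
        where
        x·P≈P : (x · generator (i , j)) ≈ P (combine {d} (fromℕ< i+1<d) j)
        x·P≈P t = begin
          (x · generator (i , j)) t                        ≡⟨ next-power i j t ⟩
          (pow K x (suc (toℕ i)) · basis K j) t            ≡⟨ cong (λ m → (pow K x m · basis K j) t) (FinP.toℕ-fromℕ< i+1<d) ⟨
          generator (fromℕ< i+1<d , j) t                   ≡⟨ cong (λ v → v t) (P-combine (fromℕ< i+1<d) j) ⟨
          P (combine {d} (fromℕ< i+1<d) j) t               ∎
      stable-at i j (no i+1≮d) = InℤSpan-resp-≈ P x·P≈P (subfamily∈span P (λ i′ → combine {d} i′ j) (λ i′ → ℤ.- lookup as i′))
        where
        i+1≡d : suc (toℕ i) ≡ d
        i+1≡d = ℕP.≤-antisym (FinP.toℕ<n i) (ℕP.≮⇒≥ i+1≮d)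
        x·P≈P : (x · generator (i , j)) ≈ linComb (λ i′ → toℚ (ℤ.- lookup as i′)) (λ i′ → P (combine {d} i′ j))
        x·P≈P t = begin
          (x · generator (i , j)) t                                    ≡⟨ next-power i j t ⟩
          (pow K x (suc (toℕ i)) · basis K j) t                        ≡⟨ cong (λ m → (pow K x m · basis K j) t) i+1≡d ⟩
          (pow K x d · basis K j) t                                    ≡⟨ mulSC-congˡ c (basis K j) top-power t ⟩
          mulSC c (linComb a′ (λ i′ → pow K x (toℕ i′))) (basis K j) t ≡⟨ mulSC-linCombˡ c a′ (λ i′ → pow K x (toℕ i′)) (basis K j) t ⟩
          linComb a′ (λ i′ → generator (i′ , j)) t                     ≡⟨ ℚL.linComb-congʳ a′ (λ i′ t → cong (λ v → v t) (sym (P-combine i′ j))) t ⟩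
          linComb a′ (λ i′ → P (combine {d} i′ j)) t                   ∎
          where
          a′ : Fin d → ℚ
          a′ i′ = toℚ (ℤ.- lookup as i′)

      stable : ∀ s → InℤSpan P (x · P s)
      stable s = stable-at (proj₁ (remQuot deg s)) (proj₂ (remQuot deg s)) (suc (toℕ (proj₁ (remQuot deg s))) ℕ.<? d)

  integral-trace-parity : ∀ K x → IsIntegral K x → ∃₂ λ t w → Trace K x ≡ toℚ t × trId K x x ≡ toℚ (t ℤ.+ ℤ.+ 2 ℤ.* w)
  integral-trace-parity K x ([] , root) = ⊥-elim (one≢0 (λ t → trans (sym (ℚP.+-identityʳ (one t))) (root t)))
    where open NumberField K
  integral-trace-parity K x (a ∷ as′ , root) =
    let t , w , trace-x , trace-x² = trace-parity (mulSC-linearʳ c x) P units stable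
    in  t , w , trans (Trace≡trace K x) trace-x , trans (Trace-square≡trace K x) trace-x²
    where
    open NumberField K
    open PowerGenerators K x a as′ root

open import Data.Integer as ℤ using (+_; ∣_∣)
import Data.Integer.Divisibility.Signed as ℤ
import Data.Nat.Divisibility as ℕ
open import Function.Bundles using (mk⇔; Equivalence)
open import Relation.Binary.PropositionalEquality using (_≡_; sym; trans; cong; subst)
open IntegerLattices using (2∣-shift)
open RationalLinearAlgebra using (toℚ-injective)
open NumberFieldTraces using (integral-trace-parity)

corollary2 : (K : NumberField) (m : ℕ) → 0 < m → TraceImage≡ K m →
    IsEvenLattice K ⇔ (2 ∣ m)
corollary2 K m _ traceImage = mk⇔ even⇒2∣m 2∣m⇒even
  where
  even⇒2∣m : IsEvenLattice K → 2 ∣ m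
  even⇒2∣m even with proj₂ (traceImage (+ m)) ℕ.∣-refl
  ... | x , x-integral , trace-x≡m with integral-trace-parity K x x-integral | even x x-integral
  ... | t , w , trace-x≡t , trace-x²≡t+2w | k , trace-x²≡2k =
    subst (2 ∣_) (cong ∣_∣ (toℚ-injective {t} {+ m} (trans (sym trace-x≡t) trace-x≡m)))
      (ℤ.∣⇒∣ᵤ (Equivalence.to (2∣-shift t w) (k , toℚ-injective {_} {+ 2 ℤ.* k} (trans (sym trace-x²≡t+2w) trace-x²≡2k))))

  2∣m⇒even : 2 ∣ m → IsEvenLattice K
  2∣m⇒even 2∣m x x-integral with integral-trace-parity K x x-integral
  ... | t , w , trace-x≡t , trace-x²≡t+2w with Equivalence.from (2∣-shift t w) (ℤ.∣ᵤ⇒∣ (ℕ.∣-trans 2∣m m∣t))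
    where m∣t = proj₁ (traceImage t) (x , x-integral , trace-x≡t)
  ... | k , t+2w≡2k = k , trans trace-x²≡t+2w (cong toℚ t+2w≡2k)
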